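{- Let $G$ and $H$ be arbitrary graphs. Then \[\max\{b_{\rm g}(G), b_{\rm g}(H)\} \le b_{\rm g}(G \boxtimes H) \le b_{\rm g}(G \,\Box\, H)\] and \[\max\{b_{\rm g}'(G), b_{\rm g}'(H)\} \le b_{\rm g}'(G \boxtimes H) \le b_{\rm g}'(G \,\Box\, H).\]
   Context: $G\,\Box\,H$ (Cartesian product) has vertex set $V(G)\times V(H)$, with $(u,v)\sim(x,y)$ iff ($u=x$ and $vy\in E(H)$) or ($ux\in E(G)$ and $v=y$). $G\boxtimes H$ (strong product) has the same vertex set, with $(u,v)\sim(x,y)$ iff they are adjacent in $G\,\Box\,H$ or ($ux\in E(G)$ and $vy\in E(H)$). The burning game on a finite simple graph $G$ is played by two players, Burner and Staller. Each vertex is either burned or unburned, and once burned it stays burned. In round 1 the starting player chooses one unburned vertex and burns it (selection phase only). Each round $t \ge 2$ consists of a spreading phase, in which every unburned vertex with a burned neighbor becomes burned, followed, if unburned vertices remain, by a selection phase in which the player whose turn it is burns one unburned vertex; the two players make the selections alternately. The game ends in the first round in which all vertices are burned (this may happen right after a spreading phase), and its length is the number of that round. Burner wants to minimize the length and Staller to maximize it. $b_{\rm g}(G)$ is the length under optimal play when Burner makes the first selection, and $b_{\rm g}'(G)$ is the length under optimal play when Staller makes the first selection. -}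

module Defs where

open import Data.Nat using (ℕ; zero; suc; _+_; _*_; _⊓_; _⊔_; _<_)
open import Data.Bool using (Bool; true; false; _∧_; _∨_; not; if_then_else_; T?)
open import Data.Fin using (Fin; remQuot; _≟_)
open import Data.List using (List; []; _∷_; map; filter; foldr)
open import Data.Bool.ListAction using (any; all)
open import Data.List.Base using (allFin)
open import Data.Product using (_×_; _,_)
open import Relation.Nullary.Decidable using (⌊_⌋)
open import Relation.Binary.PropositionalEquality using (_≡_)

record Graph : Set where
  constructor mkGraph
  field
    n   : ℕ
    adj : Fin n → Fin n → Bool
open Graph public

record IsSimple (G : Graph) : Set where
  field
    adj-sym    : ∀ i j → adj G i j ≡ adj G j i
    adj-irrefl : ∀ i → adj G i i ≡ false

_==_ : ∀ {k} → Fin k → Fin k → Bool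
a == b = ⌊ a ≟ b ⌋

_□_ : Graph → Graph → Graph
G □ H = mkGraph (n G * n H) λ p q → cart (remQuot (n H) p) (remQuot (n H) q)
  where
  cart : Fin (n G) × Fin (n H) → Fin (n G) × Fin (n H) → Bool
  cart (u , v) (x , y) = ((u == x) ∧ adj H v y) ∨ (adj G u x ∧ (v == y))

_⊠_ : Graph → Graph → Graph
G ⊠ H = mkGraph (n G * n H) λ p q → strong (remQuot (n H) p) (remQuot (n H) q)
  where
  strong : Fin (n G) × Fin (n H) → Fin (n G) × Fin (n H) → Bool
  strong (u , v) (x , y) =
    ((u == x) ∧ adj H v y) ∨ (adj G u x ∧ (v == y)) ∨ (adj G u x ∧ adj H v y)

data Player : Set where
  burner staller : Player

other : Player → Player
other burner  = staller
other staller = burner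

-- Burner minimizes, Staller maximizes (over a list of outcomes; the list is
-- nonempty whenever it is used, so the default for [] is irrelevant).
optimum : Player → List ℕ → ℕ
optimum burner  []       = 0
optimum burner  (x ∷ xs) = foldr _⊓_ x xs
optimum staller xs       = foldr _⊔_ 0 xs

module Game (G : Graph) where
  V : Set
  V = Fin (n G)

  Burned : Set
  Burned = V → Bool

  full : Burned → Bool
  full S = all S (allFin (n G))

  spread : Burned → Burned
  spread S u = S u ∨ any (λ v → adj G u v ∧ S v) (allFin (n G))

  add : Burned → V → Burned
  add S v u = S u ∨ (u == v)

  unburned : Burned → List V
  unburned S = filter (λ v → T? (not (S v))) (allFin (n G))

  -- remaining S p k : number of further rounds until the game ends, when S is
  -- the burned set at the end of some round (S not full) and p makes the next
  -- selection; k is fuel (each round burns at least one vertex, so k = n G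
  -- suffices).
  remaining : ℕ → Burned → Player → ℕ
  remaining zero    S p = 0
  remaining (suc k) S p =
    let S' = spread S in
    if full S' then 1
    else optimum p (map (λ v → let S'' = add S' v in
                          if full S'' then 1 else suc (remaining k S'' (other p)))
                        (unburned S'))

  empty : Burned
  empty _ = false

  gameLength : Player → ℕ
  gameLength p =
    optimum p (map (λ v → let S = add empty v in
                      if full S then 1 else suc (remaining (n G) S (other p)))
                   (allFin (n G)))

bg : Graph → ℕ
bg G = Game.gameLength G burner

bg′ : Graph → ℕ
bg′ G = Game.gameLength G staller

-- Call a map f : V(A) → V(B) with a section a split weak homomorphism if it
-- sends every edge of A to an edge or to a single vertex of B.  Such an f lets
-- the game on B shadow the game on A so that the burned set in B always
-- contains the f-image of the burned set in A: spreading preserves this since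
-- f maps neighbours to neighbours or to the same vertex, Burner in B answers
-- Burner's move x in A by f x (or by an arbitrary vertex if f x is already
-- burned), and Staller's move y in B is answered in A by the section of y.
-- Hence the game on B ends no later than the game on A, whoever starts.  The
-- projections of G ⊠ H onto its factors and the identity G □ H → G ⊠ H are
-- split weak homomorphisms.
module Submission where

open import Defs
open import Data.Nat using (ℕ; _≤_; _<_; _⊔_)
open import Data.Product using (_×_)

open import Data.Nat using (suc; _*_; _⊓_; z≤n; s≤s)
open import Data.Nat.Properties
  using (≤-refl; ≤-trans; m⊓n≤m; m⊓n≤n; ⊓-glb; m≤m⊔n; m≤n⊔m; ⊔-lub; module ≤-Reasoning)
open import Data.Bool using (Bool; true; false; _∧_; _∨_; not; if_then_else_; T; T?)
open import Data.Bool.Properties using (T-∧; T-∨)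
open import Data.Bool.ListAction using (any; all)
open import Data.Empty using (⊥-elim)
open import Data.Fin using (Fin; remQuot; combine; fromℕ<)
open import Data.Fin.Properties using (remQuot-combine; injective⇒≤)
open import Data.List using ([]; _∷_; map; foldr)
open import Data.List.Base using (allFin)
open import Data.List.Membership.Propositional using (_∈_)
open import Data.List.Membership.Propositional.Properties using (∈-allFin; ∈-filter⁺; ∈-filter⁻)
open import Data.List.Properties using (filter-all)
open import Data.List.Relation.Unary.All using (universal)
open import Data.List.Relation.Unary.Any using (here; there)
open import Data.Product using (_,_; proj₁; proj₂; ∃)
open import Data.Sum using (_⊎_; inj₁; inj₂; map₁)
open import Data.Unit using (tt)
open import Function using (_∘_; Equivalence)
open import Relation.Nullary using (¬_; yes; no)
open import Relation.Nullary.Decidable using (toWitness; fromWitness)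
open import Relation.Binary.PropositionalEquality using (_≡_; refl; sym; trans; cong; subst)

open Equivalence using (to; from)

T-not⁺ : ∀ {b} → ¬ T b → T (not b)
T-not⁺ {false} _ = tt
T-not⁺ {true} ¬b = ¬b tt

T-not⁻ : ∀ {b} → T (not b) → ¬ T b
T-not⁻ {false} _ ()

T-∨⁺ˡ : ∀ a {b} → T a → T (a ∨ b)
T-∨⁺ˡ a t = from (T-∨ {a}) (inj₁ t)

T-∨⁺ʳ : ∀ a {b} → T b → T (a ∨ b)
T-∨⁺ʳ a t = from (T-∨ {a}) (inj₂ t)

if-then-1-≤ : ∀ {a b x y} → (T a → T b) → (¬ T a → 1 ≤ y) → (¬ T a → ¬ T b → x ≤ y) →
              (if b then 1 else x) ≤ (if a then 1 else y)
if-then-1-≤ {true}  {true}  _   _   _  = ≤-refl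
if-then-1-≤ {true}  {false} a⇒b _   _  = ⊥-elim (a⇒b tt)
if-then-1-≤ {false} {true}  _   pos _  = pos (λ ())
if-then-1-≤ {false} {false} _   _   le = le (λ ()) (λ ())

module _ {A : Set} (p : A → Bool) where

  all-∈ : ∀ {xs x} → T (all p xs) → x ∈ xs → T (p x)
  all-∈ {_ ∷ _} t (here refl) = proj₁ (to T-∧ t)
  all-∈ {_ ∷ _} t (there x∈) = all-∈ (proj₂ (to T-∧ t)) x∈

  all-intro : ∀ xs → (∀ {x} → x ∈ xs → T (p x)) → T (all p xs)
  all-intro []       _ = tt
  all-intro (_ ∷ xs) h = from T-∧ (h (here refl) , all-intro xs (h ∘ there))

  ¬all⇒∃¬ : ∀ xs → ¬ T (all p xs) → ∃ λ x → ¬ T (p x)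
  ¬all⇒∃¬ []       ¬all = ⊥-elim (¬all tt)
  ¬all⇒∃¬ (x ∷ xs) ¬all with T? (p x)
  ... | no ¬px = x , ¬px
  ... | yes px = ¬all⇒∃¬ xs (λ t → ¬all (from T-∧ (px , t)))

  any⇒∃ : ∀ xs → T (any p xs) → ∃ λ x → T (p x)
  any⇒∃ (x ∷ xs) t with to T-∨ t
  ... | inj₁ px = x , px
  ... | inj₂ t′ = any⇒∃ xs t′

  ∈-any : ∀ {xs x} → x ∈ xs → T (p x) → T (any p xs)
  ∈-any (here refl) px = from T-∨ (inj₁ px)
  ∈-any (there x∈)  px = from T-∨ (inj₂ (∈-any x∈ px))

module _ {A : Set} (h : A → ℕ) where

  ≤-optimum-staller : ∀ {xs x} → x ∈ xs → h x ≤ optimum staller (map h xs)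
  ≤-optimum-staller (here refl) = m≤m⊔n _ _
  ≤-optimum-staller (there x∈)  = ≤-trans (≤-optimum-staller x∈) (m≤n⊔m _ _)

  optimum-glb : ∀ p {xs x c} → x ∈ xs → (∀ {y} → y ∈ xs → c ≤ h y) → c ≤ optimum p (map h xs)
  optimum-glb burner {_ ∷ xs} _ c≤ = ⊓-glb-seed xs (c≤ (here refl)) (c≤ ∘ there)
    where
    ⊓-glb-seed : ∀ xs {z c} → c ≤ z → (∀ {y} → y ∈ xs → c ≤ h y) → c ≤ foldr _⊓_ z (map h xs)
    ⊓-glb-seed []       c≤z _   = c≤z
    ⊓-glb-seed (_ ∷ xs) c≤z c≤h = ⊓-glb (c≤h (here refl)) (⊓-glb-seed xs c≤z (c≤h ∘ there))
  optimum-glb staller x∈ c≤ = ≤-trans (c≤ x∈) (≤-optimum-staller x∈)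

  optimum-burner-≤ : ∀ {xs x} → x ∈ xs → optimum burner (map h xs) ≤ h x
  optimum-burner-≤ {_ ∷ ys} (here refl) = ⊓-≤-seed ys
    where
    ⊓-≤-seed : ∀ ys {z} → foldr _⊓_ z (map h ys) ≤ z
    ⊓-≤-seed []       = ≤-refl
    ⊓-≤-seed (_ ∷ ys) = ≤-trans (m⊓n≤n _ _) (⊓-≤-seed ys)
  optimum-burner-≤ {_ ∷ _}  (there x∈) = ⊓-≤-elem x∈
    where
    ⊓-≤-elem : ∀ {ys z x} → x ∈ ys → foldr _⊓_ z (map h ys) ≤ h x
    ⊓-≤-elem (here refl) = m⊓n≤m _ _
    ⊓-≤-elem (there x∈)  = ≤-trans (m⊓n≤n _ _) (⊓-≤-elem x∈)

  optimum-staller-lub : ∀ {xs c} → (∀ {x} → x ∈ xs → h x ≤ c) → optimum staller (map h xs) ≤ c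
  optimum-staller-lub {[]}    _   = z≤n
  optimum-staller-lub {_ ∷ _} h≤c = ⊔-lub (h≤c (here refl)) (optimum-staller-lub (h≤c ∘ there))

module _ {X Y : Set} {a : X → ℕ} {b : Y → ℕ} where

  optimum-burner-mono : ∀ {xs ys y₀} → y₀ ∈ ys → (∀ {y} → y ∈ ys → ∃ λ x → x ∈ xs × a x ≤ b y) →
                        optimum burner (map a xs) ≤ optimum burner (map b ys)
  optimum-burner-mono y₀∈ answer = optimum-glb b burner y₀∈ λ y∈ →
    let (x , x∈ , ax≤by) = answer y∈ in ≤-trans (optimum-burner-≤ a x∈) ax≤by

  optimum-staller-mono : ∀ {xs ys} → (∀ {x} → x ∈ xs → ∃ λ y → y ∈ ys × a x ≤ b y) →
                         optimum staller (map a xs) ≤ optimum staller (map b ys)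
  optimum-staller-mono answer = optimum-staller-lub a λ x∈ →
    let (y , y∈ , ax≤by) = answer x∈ in ≤-trans ax≤by (≤-optimum-staller b y∈)

module Burning (G : Graph) where
  open Game G public

  moveValue : ℕ → Burned → Player → V → ℕ
  moveValue k S p v = if full (add S v) then 1 else suc (remaining k (add S v) (other p))

  1≤moveValue : ∀ k S p v → 1 ≤ moveValue k S p v
  1≤moveValue k S p v with full (add S v)
  ... | true  = ≤-refl
  ... | false = s≤s z≤n

  ∈-unburned⁺ : ∀ {S v} → ¬ T (S v) → v ∈ unburned S
  ∈-unburned⁺ {S} {v} ¬Sv = ∈-filter⁺ (λ u → T? (not (S u))) (∈-allFin v) (T-not⁺ ¬Sv)

  ∈-unburned⁻ : ∀ {S v} → v ∈ unburned S → ¬ T (S v)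
  ∈-unburned⁻ {S} v∈ = T-not⁻ (proj₂ (∈-filter⁻ (λ u → T? (not (S u))) {xs = allFin (n G)} v∈))

  ¬full⇒unburned : ∀ {S} → ¬ T (full S) → ∃ λ v → ¬ T (S v)
  ¬full⇒unburned {S} = ¬all⇒∃¬ S (allFin (n G))

  ¬full-empty : V → ¬ T (full empty)
  ¬full-empty v full-empty = all-∈ empty full-empty (∈-allFin v)

  gameLength-unburned : ∀ p → gameLength p ≡ optimum p (map (moveValue (n G) empty p) (unburned empty))
  gameLength-unburned p = cong (optimum p ∘ map (moveValue (n G) empty p))
    (sym (filter-all (λ u → T? (not (empty u))) (universal (λ _ → tt) _)))

record SplitWeakHom (A B : Graph) : Set where
  field
    hom         : Fin (n A) → Fin (n B)
    section     : Fin (n B) → Fin (n A)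
    hom∘section : ∀ y → hom (section y) ≡ y
    hom-adj     : ∀ x x′ → T (adj A x x′) → hom x ≡ hom x′ ⊎ T (adj B (hom x) (hom x′))

module Shadow {A B : Graph} (φ : SplitWeakHom A B) where
  open SplitWeakHom φ
  private
    module A = Burning A
    module B = Burning B

  -- A record rather than a function type, so that S and S′ are inferable.
  record _≼_ (S : A.Burned) (S′ : B.Burned) : Set where
    constructor hom-image⊆
    field covered : ∀ x → T (S x) → T (S′ (hom x))
  open _≼_

  ≼-empty : A.empty ≼ B.empty
  ≼-empty = hom-image⊆ λ _ ()

  ≼-full : ∀ {S S′} → S ≼ S′ → T (A.full S) → T (B.full S′)
  ≼-full {S} {S′} S≼S′ full = all-intro S′ (allFin (n B)) λ {y} _ →
    subst (T ∘ S′) (hom∘section y) (covered S≼S′ (section y) (all-∈ S full (∈-allFin (section y))))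

  ≼-spread : ∀ {S S′} → S ≼ S′ → A.spread S ≼ B.spread S′
  ≼-spread {S} {S′} S≼S′ = hom-image⊆ spread-covered
    where
    spread-covered : ∀ x → T (A.spread S x) → T (B.spread S′ (hom x))
    spread-covered x t with to (T-∨ {S x}) t
    ... | inj₁ Sx = T-∨⁺ˡ (S′ (hom x)) (covered S≼S′ x Sx)
    ... | inj₂ burning-neighbour
      with (x′ , adj∧S) ← any⇒∃ (λ v → adj A x v ∧ S v) (allFin (n A)) burning-neighbour
      with (adj-xx′ , Sx′) ← to (T-∧ {adj A x x′}) adj∧S
      with hom-adj x x′ adj-xx′
    ... | inj₁ hx≡hx′ = T-∨⁺ˡ (S′ (hom x)) (subst (T ∘ S′) (sym hx≡hx′) (covered S≼S′ x′ Sx′))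
    ... | inj₂ adj-hx-hx′ = T-∨⁺ʳ (S′ (hom x)) (∈-any (λ v → adj B (hom x) v ∧ S′ v)
                              (∈-allFin (hom x′)) (from T-∧ (adj-hx-hx′ , covered S≼S′ x′ Sx′)))

  ≼-add-hom : ∀ {S S′ x y} → S ≼ S′ → hom x ≡ y → A.add S x ≼ B.add S′ y
  ≼-add-hom {S} {S′} {x} S≼S′ refl = hom-image⊆ add-covered
    where
    add-covered : ∀ u → T (A.add S x u) → T (B.add S′ (hom x) (hom u))
    add-covered u t with to (T-∨ {S u}) t
    ... | inj₁ Su  = T-∨⁺ˡ (S′ (hom u)) (covered S≼S′ u Su)
    ... | inj₂ u≡x = T-∨⁺ʳ (S′ (hom u)) (fromWitness (cong hom (toWitness u≡x)))

  ≼-add-burned : ∀ {S S′ x y} → S ≼ S′ → T (S′ (hom x)) → A.add S x ≼ B.add S′ y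
  ≼-add-burned {S} {S′} {x} {y} S≼S′ Shx = hom-image⊆ add-covered
    where
    add-covered : ∀ u → T (A.add S x u) → T (B.add S′ y (hom u))
    add-covered u t with to (T-∨ {S u}) t
    ... | inj₁ Su  = T-∨⁺ˡ (S′ (hom u)) (covered S≼S′ u Su)
    ... | inj₂ u≡x = T-∨⁺ˡ (S′ (hom u)) (subst (T ∘ S′) (cong hom (sym (toWitness u≡x))) Shx)

  selection-≤ : ∀ {vA : A.V → ℕ} {vB : B.V → ℕ} {S S′} p →
    ¬ T (A.full S) → ¬ T (B.full S′) → S ≼ S′ →
    (∀ {x y} → A.add S x ≼ B.add S′ y → vB y ≤ vA x) →
    optimum p (map vB (B.unburned S′)) ≤ optimum p (map vA (A.unburned S))
  selection-≤ {vA} {vB} {S} {S′} burner ¬fullA ¬fullB S≼S′ move =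
    optimum-burner-mono (A.∈-unburned⁺ (proj₂ (A.¬full⇒unburned ¬fullA))) answer
    where
    answer : ∀ {x} → x ∈ A.unburned S → ∃ λ y → y ∈ B.unburned S′ × vB y ≤ vA x
    answer {x} _ with T? (S′ (hom x))
    ... | no ¬Shx = hom x , B.∈-unburned⁺ ¬Shx , move (≼-add-hom S≼S′ refl)
    ... | yes Shx = let (w , ¬Sw) = B.¬full⇒unburned ¬fullB in
                    w , B.∈-unburned⁺ ¬Sw , move (≼-add-burned S≼S′ Shx)
  selection-≤ {vA} {vB} {S} {S′} staller _ _ S≼S′ move = optimum-staller-mono answer
    where
    answer : ∀ {y} → y ∈ B.unburned S′ → ∃ λ x → x ∈ A.unburned S × vB y ≤ vA x
    answer {y} y∈ = section y , A.∈-unburned⁺ ¬Sgy , move (≼-add-hom S≼S′ (hom∘section y))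
      where
      ¬Sgy : ¬ T (S (section y))
      ¬Sgy Sgy = B.∈-unburned⁻ y∈ (subst (T ∘ S′) (hom∘section y) (covered S≼S′ (section y) Sgy))

  mutual
    remaining-≤ : ∀ {kA kB} → kB ≤ kA → ∀ {S S′} → S ≼ S′ → ∀ p → B.remaining kB S′ p ≤ A.remaining kA S p
    remaining-≤ z≤n       _    _ = z≤n
    remaining-≤ {suc kA} (s≤s k≤) {S} {S′} S≼S′ p =
      if-then-1-≤ (≼-full spread≼) selection-positive
        (λ ¬fullA ¬fullB → selection-≤ p ¬fullA ¬fullB spread≼ (moveValue-≤ k≤ p))
      where
      spread≼ : A.spread S ≼ B.spread S′
      spread≼ = ≼-spread S≼S′
      selection-positive : ¬ T (A.full (A.spread S)) →
        1 ≤ optimum p (map (A.moveValue kA (A.spread S) p) (A.unburned (A.spread S)))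
      selection-positive ¬full = optimum-glb _ p (A.∈-unburned⁺ (proj₂ (A.¬full⇒unburned ¬full)))
        λ {v} _ → A.1≤moveValue kA (A.spread S) p v

    moveValue-≤ : ∀ {kA kB} → kB ≤ kA → ∀ p {S S′ x y} → A.add S x ≼ B.add S′ y →
                  B.moveValue kB S′ p y ≤ A.moveValue kA S p x
    moveValue-≤ k≤ p add≼ =
      if-then-1-≤ (≼-full add≼) (λ _ → s≤s z≤n) (λ _ _ → s≤s (remaining-≤ k≤ add≼ (other p)))

  gameLength-≤ : A.V → ∀ p → B.gameLength p ≤ A.gameLength p
  gameLength-≤ x p = begin
    B.gameLength p
      ≡⟨ B.gameLength-unburned p ⟩
    optimum p (map (B.moveValue (n B) B.empty p) (B.unburned B.empty))
      ≤⟨ selection-≤ p (A.¬full-empty x) (B.¬full-empty (hom x)) ≼-empty (moveValue-≤ nB≤nA p) ⟩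
    optimum p (map (A.moveValue (n A) A.empty p) (A.unburned A.empty))
      ≡⟨ sym (A.gameLength-unburned p) ⟩
    A.gameLength p ∎
    where
    open ≤-Reasoning
    nB≤nA : n B ≤ n A
    nB≤nA = injective⇒≤ λ {y} {y′} gy≡gy′ →
      trans (sym (hom∘section y)) (trans (cong hom gy≡gy′) (hom∘section y′))

T-∨-weakenʳ : ∀ a b {c} → T (a ∨ b) → T (a ∨ b ∨ c)
T-∨-weakenʳ true  _    _ = tt
T-∨-weakenʳ false true _ = tt

strong-adj⇒first : ∀ e a h w → T ((e ∧ h) ∨ (a ∧ w) ∨ (a ∧ h)) → T e ⊎ T a
strong-adj⇒first true  _     _ _ _ = inj₁ tt
strong-adj⇒first false true  _ _ _ = inj₂ tt

strong-adj⇒second : ∀ e a h w → T ((e ∧ h) ∨ (a ∧ w) ∨ (a ∧ h)) → T w ⊎ T h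
strong-adj⇒second _     _     true  _     _ = inj₂ tt
strong-adj⇒second _     _     false true  _ = inj₁ tt
strong-adj⇒second true  true  false false ()
strong-adj⇒second true  false false false ()
strong-adj⇒second false true  false false ()
strong-adj⇒second false false false false ()

module _ (G H : Graph) where
  private
    π₁ : Fin (n G * n H) → Fin (n G)
    π₁ p = proj₁ (remQuot {n G} (n H) p)
    π₂ : Fin (n G * n H) → Fin (n H)
    π₂ p = proj₂ (remQuot {n G} (n H) p)

  ⊠-proj₁ : Fin (n H) → SplitWeakHom (G ⊠ H) G
  ⊠-proj₁ v₀ = record
    { hom         = π₁
    ; section     = λ u → combine u v₀
    ; hom∘section = λ u → cong proj₁ (remQuot-combine u v₀)
    ; hom-adj     = λ p q t → map₁ toWitness
        (strong-adj⇒first (π₁ p == π₁ q) (adj G (π₁ p) (π₁ q)) (adj H (π₂ p) (π₂ q)) (π₂ p == π₂ q) t)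
    }

  ⊠-proj₂ : Fin (n G) → SplitWeakHom (G ⊠ H) H
  ⊠-proj₂ u₀ = record
    { hom         = π₂
    ; section     = combine u₀
    ; hom∘section = λ v → cong proj₂ (remQuot-combine u₀ v)
    ; hom-adj     = λ p q t → map₁ toWitness
        (strong-adj⇒second (π₁ p == π₁ q) (adj G (π₁ p) (π₁ q)) (adj H (π₂ p) (π₂ q)) (π₂ p == π₂ q) t)
    }

  □-to-⊠ : SplitWeakHom (G □ H) (G ⊠ H)
  □-to-⊠ = record
    { hom         = λ p → p
    ; section     = λ p → p
    ; hom∘section = λ _ → refl
    ; hom-adj     = λ p q t → inj₂
        (T-∨-weakenʳ (π₁ p == π₁ q ∧ adj H (π₂ p) (π₂ q)) (adj G (π₁ p) (π₁ q) ∧ (π₂ p == π₂ q)) t)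
    }

open Shadow using (gameLength-≤)

proposition5p1 : (G H : Graph) → IsSimple G → IsSimple H → 0 < n G → 0 < n H →
    ((bg G ⊔ bg H ≤ bg (G ⊠ H)) × (bg (G ⊠ H) ≤ bg (G □ H)))
    × ((bg′ G ⊔ bg′ H ≤ bg′ (G ⊠ H)) × (bg′ (G ⊠ H) ≤ bg′ (G □ H)))
proposition5p1 G H _ _ 0<nG 0<nH = bounds burner , bounds staller
  where
  u₀ : Fin (n G)
  u₀ = fromℕ< 0<nG
  v₀ : Fin (n H)
  v₀ = fromℕ< 0<nH
  bounds : ∀ p →
    (Game.gameLength G p ⊔ Game.gameLength H p ≤ Game.gameLength (G ⊠ H) p)
    × (Game.gameLength (G ⊠ H) p ≤ Game.gameLength (G □ H) p)
  bounds p = ⊔-lub (gameLength-≤ (⊠-proj₁ G H v₀) (combine u₀ v₀) p)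
                   (gameLength-≤ (⊠-proj₂ G H u₀) (combine u₀ v₀) p)
           , gameLength-≤ (□-to-⊠ G H) (combine u₀ v₀) p
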